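{- Let $G$ be a $2$-connected graph and $x,y\in V(G)$. Suppose $G\setminus\{x,y\}$ has $k\ge 2$ components and $\{x,y\}$ is not an admissible 2-cut of $G$. Then (1) $G=K_{2,3}$ if $k\ge 3$; (2) $G=K_4\setminus e$ if $k=2$ and $xy\in E(G)$; (3) at least one component of $G\setminus\{x,y\}$ is an isolated vertex if $k=2$ and $xy\notin E(G)$.
   Context: Graphs are finite and simple. 2-sum: for disjoint graphs $G_1,G_2$ and, for $i=1,2$, a vertex $z_i$ of $G_i$ incident with exactly two edges $x_iz_i,y_iz_i$, let $G_i'=G_i\setminus z_i$ if $x_iy_i\notin E(G_i)$ and $G_i'=G_i\setminus z_i\setminus x_iy_i$ otherwise; the 2-sum over $z_1,z_2$ is obtained from $G_1',G_2'$ by identifying $x_1$ with $x_2$ and $y_1$ with $y_2$ and then, if $x_iy_i\in E(G_i)$ for at least one $i$, adding an edge between the two identified vertices, which are called the joins of the 2-sum. Two vertices $x,y$ of a 2-connected graph $G$ form an admissible 2-cut if $G$ can be expressed as a 2-sum of two graphs, each having fewer edges than $G$, such that $\{x,y\}$ is the set of joins of the 2-sum. -}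

module Defs where

open import Data.Nat using (ℕ; zero; suc; _+_; _<_; _≤_; _<ᵇ_)
open import Data.Fin using (Fin; zero; suc; toℕ)
open import Data.Bool using (Bool; true; false; _∧_; _xor_; if_then_else_)
open import Data.List using (List; map; allFin)
open import Data.Nat.ListAction using (sum)
open import Data.Product using (Σ; ∃; _×_; _,_)
open import Data.Sum using (_⊎_)
open import Data.Empty using (⊥)
open import Relation.Nullary using (¬_)
open import Relation.Binary.PropositionalEquality using (_≡_; _≢_; refl)

record Graph : Set where
  field
    n      : ℕ
    adj    : Fin n → Fin n → Bool
    sym    : ∀ u v → adj u v ≡ adj v u
    irrefl : ∀ v → adj v v ≡ false

open Graph public

V : Graph → Set
V G = Fin (n G)

E : (G : Graph) → V G → V G → Set
E G u v = adj G u v ≡ true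

edgeCount : Graph → ℕ
edgeCount G =
  sum (map (λ u → sum (map (λ v → if adj G u v ∧ (toℕ u <ᵇ toℕ v) then 1 else 0)
                              (allFin (n G))))
           (allFin (n G)))

-- Walks in G \ R (R = set of deleted vertices, given as a predicate)

data Reach (G : Graph) (R : V G → Set) : V G → V G → Set where
  here : ∀ {u} → ¬ R u → Reach G R u u
  step : ∀ {u w v} → ¬ R u → E G u w → Reach G R w v → Reach G R u v

ConnectedMinus : (G : Graph) → (V G → Set) → Set
ConnectedMinus G R =
  (∃ λ u → ¬ R u) × (∀ u v → ¬ R u → ¬ R v → Reach G R u v)

NoVertex : {A : Set} → A → Set
NoVertex _ = ⊥

Connected : Graph → Set
Connected G = ConnectedMinus G NoVertex

TwoConnected : Graph → Set
TwoConnected G =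
  (3 ≤ n G) × Connected G × (∀ v → ConnectedMinus G (λ w → w ≡ v))

-- G \ R has exactly k components: a labelling of the remaining vertices
-- by Fin k, onto, whose fibres are exactly the connectivity classes.
HasComponents : (G : Graph) → (V G → Set) → ℕ → Set
HasComponents G R k =
  Σ (V G → Fin k) λ c →
    (∀ u v → ¬ R u → ¬ R v → (c u ≡ c v → Reach G R u v) × (Reach G R u v → c u ≡ c v))
    × (∀ i → ∃ λ u → ¬ R u × c u ≡ i)

Pair : (G : Graph) → V G → V G → V G → Set
Pair G x y w = (w ≡ x) ⊎ (w ≡ y)

record _≅_ (G H : Graph) : Set where
  field
    to      : V G → V H
    from    : V H → V G
    from-to : ∀ u → from (to u) ≡ u
    to-from : ∀ v → to (from v) ≡ v
    pres    : ∀ u v → adj H (to u) (to v) ≡ adj G u v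

k23Side : Fin 5 → Bool
k23Side zero = true
k23Side (suc zero) = true
k23Side _ = false

k23Adj : Fin 5 → Fin 5 → Bool
k23Adj u v = k23Side u xor k23Side v

k23Sym : ∀ u v → k23Adj u v ≡ k23Adj v u
k23Sym u v with k23Side u | k23Side v
... | true  | true  = refl
... | true  | false = refl
... | false | true  = refl
... | false | false = refl

k23Irr : ∀ v → k23Adj v v ≡ false
k23Irr v with k23Side v
... | true  = refl
... | false = refl

K23 : Graph
K23 = record { n = 5 ; adj = k23Adj ; sym = k23Sym ; irrefl = k23Irr }

-- K_4 \ e : vertices 0,1,2,3, all edges except 01

k4eAdj : Fin 4 → Fin 4 → Bool
k4eAdj zero zero = false
k4eAdj zero (suc zero) = false
k4eAdj zero (suc (suc zero)) = true
k4eAdj zero (suc (suc (suc zero))) = true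
k4eAdj (suc zero) zero = false
k4eAdj (suc zero) (suc zero) = false
k4eAdj (suc zero) (suc (suc zero)) = true
k4eAdj (suc zero) (suc (suc (suc zero))) = true
k4eAdj (suc (suc zero)) zero = true
k4eAdj (suc (suc zero)) (suc zero) = true
k4eAdj (suc (suc zero)) (suc (suc zero)) = false
k4eAdj (suc (suc zero)) (suc (suc (suc zero))) = true
k4eAdj (suc (suc (suc zero))) zero = true
k4eAdj (suc (suc (suc zero))) (suc zero) = true
k4eAdj (suc (suc (suc zero))) (suc (suc zero)) = true
k4eAdj (suc (suc (suc zero))) (suc (suc (suc zero))) = false

k4eSym : ∀ u v → k4eAdj u v ≡ k4eAdj v u
k4eSym zero zero = refl
k4eSym zero (suc zero) = refl
k4eSym zero (suc (suc zero)) = refl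
k4eSym zero (suc (suc (suc zero))) = refl
k4eSym (suc zero) zero = refl
k4eSym (suc zero) (suc zero) = refl
k4eSym (suc zero) (suc (suc zero)) = refl
k4eSym (suc zero) (suc (suc (suc zero))) = refl
k4eSym (suc (suc zero)) zero = refl
k4eSym (suc (suc zero)) (suc zero) = refl
k4eSym (suc (suc zero)) (suc (suc zero)) = refl
k4eSym (suc (suc zero)) (suc (suc (suc zero))) = refl
k4eSym (suc (suc (suc zero))) zero = refl
k4eSym (suc (suc (suc zero))) (suc zero) = refl
k4eSym (suc (suc (suc zero))) (suc (suc zero)) = refl
k4eSym (suc (suc (suc zero))) (suc (suc (suc zero))) = refl

k4eIrr : ∀ v → k4eAdj v v ≡ false
k4eIrr zero = refl
k4eIrr (suc zero) = refl
k4eIrr (suc (suc zero)) = refl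
k4eIrr (suc (suc (suc zero))) = refl

K4e : Graph
K4e = record { n = 4 ; adj = k4eAdj ; sym = k4eSym ; irrefl = k4eIrr }

Deg2 : (G : Graph) → V G → V G → V G → Set
Deg2 G z x y = E G z x × E G z y × x ≢ y × (∀ w → E G z w → (w ≡ x) ⊎ (w ≡ y))

SamePair : {A : Set} → A → A → A → A → Set
SamePair u v a b = (u ≡ a × v ≡ b) ⊎ (u ≡ b × v ≡ a)

-- G is (isomorphic to) the 2-sum of G₁ and G₂ over z₁, z₂, where
-- z₁ has neighbours x₁,y₁ and z₂ has neighbours x₂,y₂, x₁ and x₂ are
-- identified to x, and y₁, y₂ are identified to y.
-- φᵢ embeds V(Gᵢ') = V(Gᵢ) \ {zᵢ} into V(G).
-- The edges of Gᵢ' are the edges of Gᵢ \ zᵢ other than xᵢyᵢ; the edge xy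
-- is added iff xᵢyᵢ ∈ E(Gᵢ) for at least one i.
record IsTwoSum (G G₁ G₂ : Graph)
                (z₁ x₁ y₁ : V G₁) (z₂ x₂ y₂ : V G₂) (x y : V G) : Set where
  field
    deg₁ : Deg2 G₁ z₁ x₁ y₁
    deg₂ : Deg2 G₂ z₂ x₂ y₂
    φ₁ : V G₁ → V G
    φ₂ : V G₂ → V G
    inj₁ : ∀ u v → u ≢ z₁ → v ≢ z₁ → φ₁ u ≡ φ₁ v → u ≡ v
    inj₂ : ∀ u v → u ≢ z₂ → v ≢ z₂ → φ₂ u ≡ φ₂ v → u ≡ v
    φ₁x : φ₁ x₁ ≡ x
    φ₁y : φ₁ y₁ ≡ y
    φ₂x : φ₂ x₂ ≡ x
    φ₂y : φ₂ y₂ ≡ y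
    meet : ∀ u v → u ≢ z₁ → v ≢ z₂ → φ₁ u ≡ φ₂ v → (φ₁ u ≡ x) ⊎ (φ₁ u ≡ y)
    cover : ∀ w → (∃ λ u → u ≢ z₁ × φ₁ u ≡ w) ⊎ (∃ λ v → v ≢ z₂ × φ₂ v ≡ w)
    edges⇒ : ∀ w w' → E G w w' →
        (∃ λ u → ∃ λ u' → u ≢ z₁ × u' ≢ z₁ × ¬ SamePair u u' x₁ y₁ ×
                          E G₁ u u' × φ₁ u ≡ w × φ₁ u' ≡ w')
      ⊎ (∃ λ v → ∃ λ v' → v ≢ z₂ × v' ≢ z₂ × ¬ SamePair v v' x₂ y₂ ×
                          E G₂ v v' × φ₂ v ≡ w × φ₂ v' ≡ w')
      ⊎ (SamePair w w' x y × (E G₁ x₁ y₁ ⊎ E G₂ x₂ y₂))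
    edges⇐ : ∀ w w' →
        ((∃ λ u → ∃ λ u' → u ≢ z₁ × u' ≢ z₁ × ¬ SamePair u u' x₁ y₁ ×
                          E G₁ u u' × φ₁ u ≡ w × φ₁ u' ≡ w')
      ⊎ (∃ λ v → ∃ λ v' → v ≢ z₂ × v' ≢ z₂ × ¬ SamePair v v' x₂ y₂ ×
                          E G₂ v v' × φ₂ v ≡ w × φ₂ v' ≡ w')
      ⊎ (SamePair w w' x y × (E G₁ x₁ y₁ ⊎ E G₂ x₂ y₂))) → E G w w'

AdmissibleTwoCut : (G : Graph) → V G → V G → Set
AdmissibleTwoCut G x y =
  ∃ λ (G₁ : Graph) → ∃ λ (G₂ : Graph) →
  ∃ λ (z₁ : V G₁) → ∃ λ (x₁ : V G₁) → ∃ λ (y₁ : V G₁) →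
  ∃ λ (z₂ : V G₂) → ∃ λ (x₂ : V G₂) → ∃ λ (y₂ : V G₂) →
    IsTwoSum G G₁ G₂ z₁ x₁ y₁ z₂ x₂ y₂ x y
    × edgeCount G₁ < edgeCount G × edgeCount G₂ < edgeCount G

HasIsolatedComponent : (G : Graph) → (V G → Set) → Set
HasIsolatedComponent G R = ∃ λ v → ¬ R v × (∀ u → ¬ R u → Reach G R v u → u ≡ v)

-- Split the components into two nonempty groups and let Pᵢ be group i
-- together with {x , y}.  The two sides Gᵢ = G[Pᵢ] plus a hinge vertex
-- adjacent to x and y (keeping the edge xy in G₁ only) form a 2-sum equal to
-- G.  A side has fewer edges than G as soon as the other group supplies three
-- spare edges: one to x, one to y and a third one; two components, one
-- component with at least two vertices, or (for G₂) the edge xy suffice.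
-- Since {x , y} is not admissible no split has spare edges on both sides,
-- and a case analysis on k leaves only the three listed configurations.

module Submission where

open import Defs hiding (sym)
open import Data.Nat using (ℕ; zero; suc; _≤_; _<_; _<ᵇ_; s≤s; z≤n)
open import Data.Nat.Properties using (<ᵇ⇒<; <⇒<ᵇ; <-irrefl; <-trans; <-cmp)
open import Data.Nat.ListAction using (sum)
open import Data.Fin using (Fin; zero; suc; toℕ; splitAt; join; punchOut)
open import Data.Fin.Properties
  using (_≟_; any?; 0≢1+n; suc-injective; splitAt-join; join-splitAt; injective⇒≤; punchOut-injective; toℕ-injective)
open import Data.List using (map; tabulate; allFin)
open import Data.Bool using (Bool; true; false; _∧_; _∨_; not; if_then_else_; T)
open import Data.Bool.Properties using (∧-comm; ∨-zeroʳ)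
open import Data.Unit using (tt)
open import Data.Empty using (⊥; ⊥-elim)
open import Data.Product using (Σ; ∃; _×_; _,_; proj₁; proj₂)
open import Data.Product.Function.Dependent.Propositional using (Σ-↔)
open import Data.Sum using (_⊎_; inj₁; inj₂; [_,_])
open import Function using (_∘_; id; _↔_; Inverse; mk↔ₛ′)
open import Function.Definitions using (Injective)
open import Function.Properties.Inverse using (↔-refl; ↔-trans)
open import Relation.Nullary using (¬_; Dec; yes; no; does; ¬?)
open import Relation.Nullary.Decidable
  using (_⊎-dec_; _×-dec_; decidable-stable; dec-true; dec-false)
open import Relation.Binary.Definitions using (tri<; tri≈; tri>)
open import Relation.Binary.PropositionalEquality
  using (_≡_; _≢_; refl; sym; trans; cong; cong₂; subst; subst₂)

-- An index below Σᵢ g (f i) is a pair (i , index below g (f i)).  The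
-- summands are listed as 'map g (tabulate f)', the shape used by edgeCount.
module SumIndex {A : Set} (g : A → ℕ) where

  Fibres : ∀ {n} → (Fin n → A) → Set
  Fibres {n} f = Σ (Fin n) (λ i → Fin (g (f i)))

  rest : ∀ {n} → (Fin (suc n) → A) → ℕ
  rest f = sum (map g (tabulate (f ∘ suc)))

  split : ∀ {n} (f : Fin n → A) → Fin (sum (map g (tabulate f))) → Fibres f
  split {suc n} f i with splitAt (g (f zero)) i
  ... | inj₁ a = zero , a
  ... | inj₂ b = let (j , w) = split (f ∘ suc) b in suc j , w

  merge : ∀ {n} (f : Fin n → A) → Fibres f → Fin (sum (map g (tabulate f)))
  merge {suc n} f (zero  , a) = join (g (f zero)) _ (inj₁ a)
  merge {suc n} f (suc i , b) = join (g (f zero)) _ (inj₂ (merge (f ∘ suc) (i , b)))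

  merge-split : ∀ {n} (f : Fin n → A) i → merge f (split f i) ≡ i
  merge-split {suc n} f i with splitAt (g (f zero)) i in eq
  ... | inj₁ a = trans (cong (join (g (f zero)) (rest f)) (sym eq))
                       (join-splitAt (g (f zero)) (rest f) i)
  ... | inj₂ b = trans (cong (λ t → join (g (f zero)) (rest f) (inj₂ t)) (merge-split (f ∘ suc) b))
                       (trans (cong (join (g (f zero)) (rest f)) (sym eq))
                              (join-splitAt (g (f zero)) (rest f) i))

  split-merge : ∀ {n} (f : Fin n → A) p → split f (merge f p) ≡ p
  split-merge {suc n} f (zero , a)
    rewrite splitAt-join (g (f zero)) (rest f) (inj₁ a) = refl
  split-merge {suc n} f (suc i , b)
    rewrite splitAt-join (g (f zero)) (rest f) (inj₂ (merge (f ∘ suc) (i , b)))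
          | split-merge (f ∘ suc) (i , b) = refl

  sum↔ : ∀ {n} (f : Fin n → A) → Fin (sum (map g (tabulate f))) ↔ Fibres f
  sum↔ f = mk↔ₛ′ (split f) (merge f) (split-merge f) (merge-split f)

<-by-injection : ∀ {a b} {A B : Set} → Fin a ↔ A → Fin b ↔ B →
                 (F : A → B) → Injective _≡_ _≡_ F →
                 (t : B) → (∀ s → F s ≢ t) → a < b
<-by-injection {a} {suc b} enumA enumB F F-inj t missed =
  s≤s (injective⇒≤ {f = h} h-inj)
  where
  module A = Inverse enumA
  module B = Inverse enumB
  code : Fin a → Fin (suc b)
  code = B.from ∘ F ∘ A.to
  missed′ : ∀ i → B.from t ≢ code i
  missed′ i eq = missed (A.to i)
    (trans (sym (B.strictlyInverseˡ _)) (trans (cong B.to (sym eq)) (B.strictlyInverseˡ t)))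
  -- remove the unused code B.from t to land in Fin b
  h : Fin a → Fin b
  h i = punchOut (missed′ i)
  h-inj : Injective _≡_ _≡_ h
  h-inj {i} {j} eq =
    trans (sym (A.strictlyInverseʳ i))
      (trans (cong A.from (F-inj (trans (sym (B.strictlyInverseˡ _))
               (trans (cong B.to (punchOut-injective (missed′ i) (missed′ j) eq))
                      (B.strictlyInverseˡ _)))))
             (A.strictlyInverseʳ j))
<-by-injection {b = zero} enumA enumB F F-inj t missed with Inverse.from enumB t
... | ()

module _ {A : Set} where

  SamePair-sym : {s t p q : A} → SamePair s t p q → SamePair p q s t
  SamePair-sym (inj₁ (refl , refl)) = inj₁ (refl , refl)
  SamePair-sym (inj₂ (refl , refl)) = inj₂ (refl , refl)

  SamePair-trans : {s t p q a b : A} → SamePair s t p q → SamePair p q a b → SamePair s t a b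
  SamePair-trans (inj₁ (refl , refl)) sp = sp
  SamePair-trans (inj₂ (refl , refl)) (inj₁ (refl , refl)) = inj₂ (refl , refl)
  SamePair-trans (inj₂ (refl , refl)) (inj₂ (refl , refl)) = inj₁ (refl , refl)

  SamePair-flip : {s t p q : A} → SamePair s t p q → SamePair t s p q
  SamePair-flip (inj₁ (a , b)) = inj₂ (b , a)
  SamePair-flip (inj₂ (a , b)) = inj₁ (b , a)

  SamePair-resp : {s t p q s′ t′ p′ q′ : A} → s ≡ s′ → t ≡ t′ → p ≡ p′ → q ≡ q′ →
                  SamePair s t p q → SamePair s′ t′ p′ q′
  SamePair-resp refl refl refl refl sp = sp

  SamePair-member : {s t p q : A} → SamePair s t p q → p ≡ s ⊎ p ≡ t
  SamePair-member (inj₁ (refl , refl)) = inj₁ refl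
  SamePair-member (inj₂ (refl , refl)) = inj₂ refl

SamePair-map : {A B : Set} (h : A → B) {s t p q : A} →
               SamePair s t p q → SamePair (h s) (h t) (h p) (h q)
SamePair-map h (inj₁ (refl , refl)) = inj₁ (refl , refl)
SamePair-map h (inj₂ (refl , refl)) = inj₂ (refl , refl)

E-sym : (G : Graph) {u v : V G} → E G u v → E G v u
E-sym G {u} {v} e = trans (Graph.sym G v u) e

E-irrefl : (G : Graph) {u v : V G} → E G u v → u ≢ v
E-irrefl G {u} e refl with trans (sym e) (irrefl G u)
... | ()

E-SamePair : (G : Graph) {v w p q : V G} → SamePair v w p q → E G p q → E G v w
E-SamePair G (inj₁ (refl , refl)) e = e
E-SamePair G (inj₂ (refl , refl)) e = E-sym G e

counted : (G : Graph) → V G → V G → Bool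
counted G u v = adj G u v ∧ (toℕ u <ᵇ toℕ v)

counted⇒ : (G : Graph) {u v : V G} → counted G u v ≡ true → E G u v × toℕ u < toℕ v
counted⇒ G {u} {v} c with adj G u v | toℕ u <ᵇ toℕ v in lt
... | true | true = refl , <ᵇ⇒< (toℕ u) (toℕ v) (subst T (sym lt) tt)

⇒counted : (G : Graph) {u v : V G} → E G u v → toℕ u < toℕ v → counted G u v ≡ true
⇒counted G {u} {v} e u<v rewrite e with toℕ u <ᵇ toℕ v | <⇒<ᵇ u<v
... | true | _ = refl

Marker : Bool → Set
Marker b = Fin (if b then 1 else 0)

mark : ∀ {b} → b ≡ true → Marker b
mark refl = zero

marked : ∀ b → Marker b → b ≡ true
marked true _ = refl

Marker-unique : ∀ b (m m′ : Marker b) → m ≡ m′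
Marker-unique true zero zero = refl

-- An edge of G, coded by its endpoints in increasing order.
Edge : Graph → Set
Edge G = Σ (V G) λ u → Σ (V G) λ v → Marker (counted G u v)

edges↔ : (G : Graph) → Fin (edgeCount G) ↔ Edge G
edges↔ G = ↔-trans (SumIndex.sum↔ (λ u → sum (map (row u) (allFin (n G)))) id)
                   (Σ-↔ ↔-refl (SumIndex.sum↔ (row _) id))
  where
  row : V G → V G → ℕ
  row u v = if counted G u v then 1 else 0

Edge-ext : (G : Graph) {u v u′ v′ : V G} → u ≡ u′ → v ≡ v′ →
           (m : Marker (counted G u v)) (m′ : Marker (counted G u′ v′)) →
           _≡_ {A = Edge G} (u , v , m) (u′ , v′ , m′)
Edge-ext G {u} {v} refl refl m m′ = cong (λ t → u , v , t) (Marker-unique _ m m′)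

edgeOf : (G : Graph) (a b : V G) → E G a b → Edge G
edgeOf G a b e with <-cmp (toℕ a) (toℕ b)
... | tri< a<b _ _ = a , b , mark (⇒counted G e a<b)
... | tri≈ _ a≡b _ = ⊥-elim (E-irrefl G e (toℕ-injective a≡b))
... | tri> _ _ b<a = b , a , mark (⇒counted G (E-sym G e) b<a)

edgeOf-ends : (G : Graph) (a b : V G) (e : E G a b) →
              SamePair (proj₁ (edgeOf G a b e)) (proj₁ (proj₂ (edgeOf G a b e))) a b
edgeOf-ends G a b e with <-cmp (toℕ a) (toℕ b)
... | tri< _ _ _ = inj₁ (refl , refl)
... | tri≈ _ a≡b _ = ⊥-elim (E-irrefl G e (toℕ-injective a≡b))
... | tri> _ _ _ = inj₂ (refl , refl)

increasing-pair : {G : Graph} {u v u′ v′ : V G} → toℕ u < toℕ v → toℕ u′ < toℕ v′ →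
                  SamePair u v u′ v′ → u ≡ u′ × v ≡ v′
increasing-pair _ _ (inj₁ eqs) = eqs
increasing-pair u<v v<u (inj₂ (refl , refl)) = ⊥-elim (<-irrefl refl (<-trans u<v v<u))

fewerEdges : (G H : Graph) (f g : V G → V G → V H) →
  (∀ u v → E G u v → E H (f u v) (g u v)) →
  (∀ u v u′ v′ → E G u v → E G u′ v′ →
     SamePair (f u v) (g u v) (f u′ v′) (g u′ v′) → SamePair u v u′ v′) →
  (a b : V H) → E H a b → (∀ u v → E G u v → ¬ SamePair (f u v) (g u v) a b) →
  edgeCount G < edgeCount H
fewerEdges G H f g f-edge f-inj a b ab avoids =
  <-by-injection (edges↔ G) (edges↔ H) image image-inj (edgeOf H a b ab) image-avoids
  where
  valid : ((u , v , m) : Edge G) → E G u v × toℕ u < toℕ v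
  valid (u , v , m) = counted⇒ G (marked _ m)

  image : Edge G → Edge H
  image (u , v , m) = edgeOf H (f u v) (g u v) (f-edge u v (proj₁ (valid (u , v , m))))

  sameEnds : ∀ {p q p′ q′} (e : E H p q) (e′ : E H p′ q′) →
             edgeOf H p q e ≡ edgeOf H p′ q′ e′ → SamePair p q p′ q′
  sameEnds {p} {q} {p′} {q′} e e′ eq =
    SamePair-trans (SamePair-sym (edgeOf-ends H p q e))
      (subst (λ c → SamePair (proj₁ c) (proj₁ (proj₂ c)) p′ q′) (sym eq) (edgeOf-ends H p′ q′ e′))

  image-inj : Injective _≡_ _≡_ image
  image-inj {u , v , m} {u′ , v′ , m′} eq =
    let (uv , u<v) = valid (u , v , m)
        (uv′ , u<v′) = valid (u′ , v′ , m′)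
        (u≡ , v≡) = increasing-pair {G} u<v u<v′
                      (f-inj u v u′ v′ uv uv′ (sameEnds _ _ eq))
    in Edge-ext G u≡ v≡ m m′

  image-avoids : ∀ e → image e ≢ edgeOf H a b ab
  image-avoids (u , v , m) eq = avoids u v (proj₁ (valid (u , v , m))) (sameEnds _ _ eq)

record Enumeration (n : ℕ) (P : Fin n → Bool) : Set where
  field
    size     : ℕ
    elem     : Fin size → Fin n
    injective : ∀ i j → elem i ≡ elem j → i ≡ j
    valid    : ∀ i → P (elem i) ≡ true
    complete : ∀ v → P v ≡ true → ∃ λ i → elem i ≡ v

enumerate : ∀ n (P : Fin n → Bool) → Enumeration n P
enumerate zero P = record { size = zero ; elem = λ () ; injective = λ () ; valid = λ () ; complete = λ () }
enumerate (suc n) P with P zero in P0 | enumerate n (P ∘ suc)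
... | true | rest = record
  { size = suc size ; elem = elem′ ; injective = injective′ ; valid = valid′ ; complete = complete′ }
  where
  open Enumeration rest
  elem′ : Fin (suc size) → Fin (suc n)
  elem′ zero = zero
  elem′ (suc i) = suc (elem i)
  injective′ : ∀ i j → elem′ i ≡ elem′ j → i ≡ j
  injective′ zero zero _ = refl
  injective′ (suc i) (suc j) eq = cong suc (injective i j (suc-injective eq))
  valid′ : ∀ i → P (elem′ i) ≡ true
  valid′ zero = P0
  valid′ (suc i) = valid i
  complete′ : ∀ v → P v ≡ true → ∃ λ i → elem′ i ≡ v
  complete′ zero _ = zero , refl
  complete′ (suc v) Pv = let (i , eq) = complete v Pv in suc i , cong suc eq
... | false | rest = record
  { size = size ; elem = suc ∘ elem ; injective = λ i j → injective i j ∘ suc-injective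
  ; valid = valid ; complete = complete′ }
  where
  open Enumeration rest
  complete′ : ∀ v → P v ≡ true → ∃ λ i → suc (elem i) ≡ v
  complete′ zero Pv with trans (sym P0) Pv
  ... | ()
  complete′ (suc v) Pv = let (i , eq) = complete v Pv in i , cong suc eq

module CutTest (G : Graph) (x y : V G) where

  Cut : V G → Set
  Cut = Pair G x y

  cut? : ∀ v → Dec (Cut v)
  cut? v = (v ≟ x) ⊎-dec (v ≟ y)

  isCut : V G → Bool
  isCut v with cut? v
  ... | yes _ = true
  ... | no _  = false

  isCut-true : ∀ {v} → Cut v → isCut v ≡ true
  isCut-true {v} cv with cut? v
  ... | yes _ = refl
  ... | no ¬cv = ⊥-elim (¬cv cv)

  isCut-false : ∀ {v} → ¬ Cut v → isCut v ≡ false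
  isCut-false {v} ¬cv with cut? v
  ... | yes cv = ⊥-elim (¬cv cv)
  ... | no _   = refl

  isCut-sound : ∀ {v} → isCut v ≡ true → Cut v
  isCut-sound {v} eq with cut? v
  isCut-sound refl | yes cv = cv

  bothCut : V G → V G → Bool
  bothCut v w = isCut v ∧ isCut w

  bothCut-true : ∀ {v w} → Cut v → Cut w → bothCut v w ≡ true
  bothCut-true cv cw rewrite isCut-true cv | isCut-true cw = refl

  bothCut-false : ∀ {v w} → ¬ (Cut v × Cut w) → bothCut v w ≡ false
  bothCut-false {v} {w} ¬both with cut? v | cut? w
  ... | yes cv | yes cw = ⊥-elim (¬both (cv , cw))
  ... | yes _  | no _   = refl
  ... | no _   | _      = refl

  cutEdge : ∀ {v w} → E G v w → Cut v → Cut w → SamePair v w x y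
  cutEdge e (inj₁ refl) (inj₁ refl) = ⊥-elim (E-irrefl G e refl)
  cutEdge e (inj₁ refl) (inj₂ refl) = inj₁ (refl , refl)
  cutEdge e (inj₂ refl) (inj₁ refl) = inj₂ (refl , refl)
  cutEdge e (inj₂ refl) (inj₂ refl) = ⊥-elim (E-irrefl G e refl)

  SamePair-cut : ∀ {v w} → SamePair v w x y → Cut v × Cut w
  SamePair-cut (inj₁ (refl , refl)) = inj₁ refl , inj₂ refl
  SamePair-cut (inj₂ (refl , refl)) = inj₂ refl , inj₁ refl


-- The side of a 2-sum decomposition of G along {x , y} spanned by a vertex
-- set P ⊇ {x , y}: the induced subgraph G[P] plus a new hinge vertex joined
-- to x and y, where the edge xy of G is kept only if keep holds.  Vertex 0 is
-- the hinge and vertex suc i is the i-th element of P.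
module SideGraph (G : Graph) {x y : V G} (x≢y : x ≢ y)
                 (P : V G → Bool) (Px : P x ≡ true) (Py : P y ≡ true) (keep : Bool) where

  open CutTest G x y
  open Enumeration (enumerate (n G) P) public

  sideAdj : Fin (suc size) → Fin (suc size) → Bool
  sideAdj zero    zero    = false
  sideAdj zero    (suc j) = isCut (elem j)
  sideAdj (suc i) zero    = isCut (elem i)
  sideAdj (suc i) (suc j) = adj G (elem i) (elem j) ∧ (keep ∨ not (bothCut (elem i) (elem j)))

  sideAdj-sym : ∀ u v → sideAdj u v ≡ sideAdj v u
  sideAdj-sym zero    zero    = refl
  sideAdj-sym zero    (suc j) = refl
  sideAdj-sym (suc i) zero    = refl
  sideAdj-sym (suc i) (suc j)
    rewrite Graph.sym G (elem i) (elem j) | ∧-comm (isCut (elem i)) (isCut (elem j)) = refl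

  sideAdj-irrefl : ∀ v → sideAdj v v ≡ false
  sideAdj-irrefl zero    = refl
  sideAdj-irrefl (suc i) rewrite irrefl G (elem i) = refl

  Side : Graph
  Side = record { n = suc size ; adj = sideAdj ; sym = sideAdj-sym ; irrefl = sideAdj-irrefl }

  hinge : V Side
  hinge = zero

  embed : V Side → V G
  embed zero    = x
  embed (suc i) = elem i

  xᵢ yᵢ : Fin size
  xᵢ = proj₁ (complete x Px)
  yᵢ = proj₁ (complete y Py)

  embed-x : embed (suc xᵢ) ≡ x
  embed-x = proj₂ (complete x Px)

  embed-y : embed (suc yᵢ) ≡ y
  embed-y = proj₂ (complete y Py)

  embed-injective : ∀ u v → u ≢ hinge → v ≢ hinge → embed u ≡ embed v → u ≡ v
  embed-injective zero    _       u≢h _   _  = ⊥-elim (u≢h refl)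
  embed-injective (suc i) zero    _   v≢h _  = ⊥-elim (v≢h refl)
  embed-injective (suc i) (suc j) _   _   eq = cong suc (injective i j eq)

  embed-valid : ∀ u → u ≢ hinge → P (embed u) ≡ true
  embed-valid zero    u≢h = ⊥-elim (u≢h refl)
  embed-valid (suc i) _   = valid i

  embed-complete : ∀ w → P w ≡ true → ∃ λ u → u ≢ hinge × embed u ≡ w
  embed-complete w Pw = let (i , eq) = complete w Pw in suc i , (λ ()) , eq

  hinge-deg2 : Deg2 Side hinge (suc xᵢ) (suc yᵢ)
  hinge-deg2 = subst (λ v → isCut v ≡ true) (sym embed-x) (isCut-true (inj₁ refl))
             , subst (λ v → isCut v ≡ true) (sym embed-y) (isCut-true (inj₂ refl))
             , (λ eq → x≢y (trans (sym embed-x) (trans (cong embed eq) embed-y)))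
             , neighbours
    where
    neighbours : ∀ w → E Side hinge w → (w ≡ suc xᵢ) ⊎ (w ≡ suc yᵢ)
    neighbours (suc j) e with isCut-sound e
    ... | inj₁ eq = inj₁ (cong suc (injective j xᵢ (trans eq (sym embed-x))))
    ... | inj₂ eq = inj₂ (cong suc (injective j yᵢ (trans eq (sym embed-y))))

  inner⇒ : ∀ i j → E Side (suc i) (suc j) → E G (elem i) (elem j)
  inner⇒ i j e with adj G (elem i) (elem j)
  inner⇒ i j () | false
  ... | true = refl

  embed-edge : ∀ u v → u ≢ hinge → v ≢ hinge → E Side u v → E G (embed u) (embed v)
  embed-edge zero    _       u≢h _   _ = ⊥-elim (u≢h refl)
  embed-edge (suc i) zero    _   v≢h _ = ⊥-elim (v≢h refl)
  embed-edge (suc i) (suc j) _   _   e = inner⇒ i j e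

  cutEdge⇒ : E Side (suc xᵢ) (suc yᵢ) → E G x y
  cutEdge⇒ e = subst₂ (E G) embed-x embed-y (inner⇒ xᵢ yᵢ e)

  inner⇐ : ∀ i j → E G (elem i) (elem j) → ¬ (Cut (elem i) × Cut (elem j)) →
           E Side (suc i) (suc j)
  inner⇐ i j e notBoth rewrite e | bothCut-false notBoth = ∨-zeroʳ keep

  cutEdge⇐ : keep ≡ true → E G x y → E Side (suc xᵢ) (suc yᵢ)
  cutEdge⇐ refl e rewrite embed-x | embed-y | e = refl

  -- ww′ is the image of an edge of the side other than the one between x and y
  -- (the form used by IsTwoSum)
  Lifted : V G → V G → Set
  Lifted w w′ = ∃ λ u → ∃ λ u′ → u ≢ hinge × u′ ≢ hinge × ¬ SamePair u u′ (suc xᵢ) (suc yᵢ) ×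
                                E Side u u′ × embed u ≡ w × embed u′ ≡ w′

  lift : ∀ w w′ → E G w w′ → ¬ (Cut w × Cut w′) → P w ≡ true → P w′ ≡ true → Lifted w w′
  lift w w′ e notBoth Pw Pw′ with complete w Pw | complete w′ Pw′
  ... | i , refl | i′ , refl =
    suc i , suc i′ , (λ ()) , (λ ()) , notCut , inner⇐ i i′ e notBoth , refl , refl
    where
    notCut : ¬ SamePair (suc i) (suc i′) (suc xᵢ) (suc yᵢ)
    notCut sp = notBoth (SamePair-cut (SamePair-resp refl refl embed-x embed-y (SamePair-map embed sp)))

  outside-not-inner : ∀ i j {p q} → P p ≡ false → ¬ SamePair (elem i) (elem j) p q
  outside-not-inner i j {p} Pp sp with SamePair-member sp
  ... | inj₁ refl with trans (sym Pp) (valid i)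
  ...   | ()
  outside-not-inner i j {p} Pp sp | inj₂ refl with trans (sym Pp) (valid j)
  ...   | ()

  cutEdge-not-inner : keep ≡ false → ∀ i j → E Side (suc i) (suc j) →
                      ¬ SamePair (elem i) (elem j) x y
  cutEdge-not-inner refl i j e sp =
    excluded (adj G (elem i) (elem j)) (bothCut-true (proj₁ ends) (proj₂ ends)) e
    where
    ends = SamePair-cut sp
    excluded : ∀ a {b} → b ≡ true → a ∧ not b ≡ true → ⊥
    excluded true  refl ()
    excluded false _    ()

  -- Edges of G that the side does not account for: an edge αx and an edge
  -- βy with α, β outside P, and an edge γ different from both that is not
  -- an edge of the side between non-hinge vertices.
  record SpareEdges : Set where
    field
      α β γ₁ γ₂   : V G
      α-x         : E G α x
      β-y         : E G β y
      γ           : E G γ₁ γ₂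
      α-out       : P α ≡ false
      β-out       : P β ≡ false
      γ≢αx        : ¬ SamePair γ₁ γ₂ α x
      γ≢βy        : ¬ SamePair γ₁ γ₂ β y
      γ-not-inner : ∀ i j → E Side (suc i) (suc j) → ¬ SamePair (elem i) (elem j) γ₁ γ₂

  -- Given spare edges, the side has fewer edges than G: edges of G[P] are
  -- counted as themselves, the hinge edges to x and y are charged to αx and
  -- βy, and γ is never hit.
  side-fewerEdges : SpareEdges → edgeCount Side < edgeCount G
  side-fewerEdges spare = fewerEdges Side G end (λ u v → end v u) end-edge end-injective γ₁ γ₂ γ end-avoids
    where
    open SpareEdges spare

    -- the edge of G charged for the hinge edge to the cut vertex v
    partner : V G → V G
    partner v with v ≟ x
    ... | yes _ = α
    ... | no _  = β

    partner-out : ∀ v → P (partner v) ≡ false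
    partner-out v with v ≟ x
    ... | yes _ = α-out
    ... | no _  = β-out

    partner-edge : ∀ {v} → Cut v → E G (partner v) v
    partner-edge {v} cv with v ≟ x | cv
    ... | yes refl | _          = α-x
    ... | no v≢x   | inj₁ v≡x   = ⊥-elim (v≢x v≡x)
    ... | no _     | inj₂ refl  = β-y

    partner-avoids : ∀ {v} → Cut v → ¬ SamePair (partner v) v γ₁ γ₂
    partner-avoids {v} cv sp with v ≟ x | cv
    ... | yes refl | _          = γ≢αx (SamePair-sym sp)
    ... | no v≢x   | inj₁ v≡x   = v≢x v≡x
    ... | no _     | inj₂ refl  = γ≢βy (SamePair-sym sp)

    -- the end at u of the image of the side edge uv
    end : V Side → V Side → V G
    end zero    v = partner (embed v)
    end (suc i) v = elem i

    -- a left inverse of end, recovering the side vertex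
    recover : V G → V Side
    recover w with any? (λ i → elem i ≟ w)
    ... | yes (i , _) = suc i
    ... | no _        = hinge

    recover-elem : ∀ i → recover (elem i) ≡ suc i
    recover-elem i with any? (λ j → elem j ≟ elem i)
    ... | yes (j , eq) = cong suc (injective j i eq)
    ... | no none      = ⊥-elim (none (i , refl))

    recover-out : ∀ {w} → P w ≡ false → recover w ≡ hinge
    recover-out {w} out with any? (λ i → elem i ≟ w)
    ... | no _ = refl
    ... | yes (i , refl) with trans (sym out) (valid i)
    ...   | ()

    end-recover : ∀ u v → recover (end u v) ≡ u
    end-recover zero    v = recover-out (partner-out (embed v))
    end-recover (suc i) v = recover-elem i

    end-edge : ∀ u v → E Side u v → E G (end u v) (end v u)
    end-edge zero    (suc j) e = partner-edge (isCut-sound e)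
    end-edge (suc i) zero    e = E-sym G (partner-edge (isCut-sound e))
    end-edge (suc i) (suc j) e = inner⇒ i j e

    end-injective : ∀ u v u′ v′ → E Side u v → E Side u′ v′ →
      SamePair (end u v) (end v u) (end u′ v′) (end v′ u′) → SamePair u v u′ v′
    end-injective u v u′ v′ _ _ sp =
      SamePair-resp (end-recover u v) (end-recover v u) (end-recover u′ v′) (end-recover v′ u′)
                    (SamePair-map recover sp)

    end-avoids : ∀ u v → E Side u v → ¬ SamePair (end u v) (end v u) γ₁ γ₂
    end-avoids zero    (suc j) e sp = partner-avoids (isCut-sound e) sp
    end-avoids (suc i) zero    e sp = partner-avoids (isCut-sound e) (SamePair-flip sp)
    end-avoids (suc i) (suc j) e sp = γ-not-inner i j e sp

module Split (G : Graph) {x y : V G} (x≢y : x ≢ y) (P₁ P₂ : V G → Bool)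
  (P₁x : P₁ x ≡ true) (P₁y : P₁ y ≡ true) (P₂x : P₂ x ≡ true) (P₂y : P₂ y ≡ true)
  (cover : ∀ v → P₁ v ≡ true ⊎ P₂ v ≡ true)
  (meet : ∀ v → P₁ v ≡ true → P₂ v ≡ true → Pair G x y v)
  (closed : ∀ w w′ → E G w w′ → ¬ (Pair G x y w × Pair G x y w′) →
            (P₁ w ≡ true × P₁ w′ ≡ true) ⊎ (P₂ w ≡ true × P₂ w′ ≡ true)) where

  open CutTest G x y
  module S₁ = SideGraph G x≢y P₁ P₁x P₁y true
  module S₂ = SideGraph G x≢y P₂ P₂x P₂y false

  twoSum : IsTwoSum G S₁.Side S₂.Side S₁.hinge (suc S₁.xᵢ) (suc S₁.yᵢ)
                                      S₂.hinge (suc S₂.xᵢ) (suc S₂.yᵢ) x y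
  twoSum = record
    { deg₁ = S₁.hinge-deg2 ; deg₂ = S₂.hinge-deg2
    ; φ₁ = S₁.embed ; φ₂ = S₂.embed
    ; inj₁ = S₁.embed-injective ; inj₂ = S₂.embed-injective
    ; φ₁x = S₁.embed-x ; φ₁y = S₁.embed-y ; φ₂x = S₂.embed-x ; φ₂y = S₂.embed-y
    ; meet = λ u v u≢h v≢h eq →
        meet (S₁.embed u) (S₁.embed-valid u u≢h)
             (subst (λ w → P₂ w ≡ true) (sym eq) (S₂.embed-valid v v≢h))
    ; cover = covered
    ; edges⇒ = edges⇒
    ; edges⇐ = edges⇐ }
    where
    covered : ∀ w → (∃ λ u → u ≢ S₁.hinge × S₁.embed u ≡ w) ⊎ (∃ λ v → v ≢ S₂.hinge × S₂.embed v ≡ w)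
    covered w with cover w
    ... | inj₁ P₁w = inj₁ (S₁.embed-complete w P₁w)
    ... | inj₂ P₂w = inj₂ (S₂.embed-complete w P₂w)

    CutEdge : V G → V G → Set
    CutEdge w w′ = SamePair w w′ x y × (E S₁.Side (suc S₁.xᵢ) (suc S₁.yᵢ) ⊎ E S₂.Side (suc S₂.xᵢ) (suc S₂.yᵢ))

    edges⇒ : ∀ w w′ → E G w w′ → S₁.Lifted w w′ ⊎ S₂.Lifted w w′ ⊎ CutEdge w w′
    edges⇒ w w′ e with cut? w ×-dec cut? w′
    ... | yes (cw , cw′) =
      let xy = cutEdge e cw cw′ in
      inj₂ (inj₂ (xy , inj₁ (S₁.cutEdge⇐ refl (E-SamePair G (SamePair-sym xy) e))))
    ... | no notBoth with closed w w′ e notBoth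
    ...   | inj₁ (p , p′) = inj₁ (S₁.lift w w′ e notBoth p p′)
    ...   | inj₂ (p , p′) = inj₂ (inj₁ (S₂.lift w w′ e notBoth p p′))

    edges⇐ : ∀ w w′ → S₁.Lifted w w′ ⊎ S₂.Lifted w w′ ⊎ CutEdge w w′ → E G w w′
    edges⇐ w w′ (inj₁ (u , u′ , u≢h , u′≢h , _ , e , refl , refl)) = S₁.embed-edge u u′ u≢h u′≢h e
    edges⇐ w w′ (inj₂ (inj₁ (u , u′ , u≢h , u′≢h , _ , e , refl , refl))) = S₂.embed-edge u u′ u≢h u′≢h e
    edges⇐ w w′ (inj₂ (inj₂ (xy , inj₁ e))) = E-SamePair G xy (S₁.cutEdge⇒ e)
    edges⇐ w w′ (inj₂ (inj₂ (xy , inj₂ e))) = E-SamePair G xy (S₂.cutEdge⇒ e)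

≅-by-bijection : (G H : Graph) (to : V H → V G) (from : V G → V H) →
  (∀ v → to (from v) ≡ v) → (∀ a → from (to a) ≡ a) →
  (∀ a b → adj H a b ≡ adj G (to a) (to b)) → G ≅ H
≅-by-bijection G H to from to-from from-to pres = record
  { to = from ; from = to ; from-to = to-from ; to-from = from-to
  ; pres = λ u v → trans (pres (from u) (from v)) (cong₂ (adj G) (to-from u) (to-from v)) }

record Skeleton (G : Graph) (x y : V G) (k : ℕ) : Set where
  field
    x≢y         : x ≢ y
    spoke       : Fin k → V G
    index       : V G → Fin k
    spoke-x     : ∀ i → spoke i ≢ x
    spoke-y     : ∀ i → spoke i ≢ y
    index-spoke : ∀ i → index (spoke i) ≡ i
    spoke-index : ∀ v → v ≢ x → v ≢ y → spoke (index v) ≡ v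
    spoke~x     : ∀ i → E G (spoke i) x
    spoke~y     : ∀ i → E G (spoke i) y
    spoke≁spoke : ∀ i j → adj G (spoke i) (spoke j) ≡ false

  relabel : {A : Set} → A → A → (Fin k → A) → V G → A
  relabel a b f v with v ≟ x | v ≟ y
  ... | yes _ | _     = a
  ... | no _  | yes _ = b
  ... | no _  | no _  = f (index v)

  module _ {A : Set} (a b : A) (f : Fin k → A) where

    relabel-x : relabel a b f x ≡ a
    relabel-x with x ≟ x
    ... | yes _  = refl
    ... | no x≢x = ⊥-elim (x≢x refl)

    relabel-y : relabel a b f y ≡ b
    relabel-y with y ≟ x | y ≟ y
    ... | yes y≡x | _      = ⊥-elim (x≢y (sym y≡x))
    ... | no _    | yes _  = refl
    ... | no _    | no y≢y = ⊥-elim (y≢y refl)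

    relabel-spoke : ∀ i → relabel a b f (spoke i) ≡ f i
    relabel-spoke i with spoke i ≟ x | spoke i ≟ y
    ... | yes s≡x | _     = ⊥-elim (spoke-x i s≡x)
    ... | no _    | yes s≡y = ⊥-elim (spoke-y i s≡y)
    ... | no _    | no _  = cong f (index-spoke i)

    relabel-inverse : (to : A → V G) → to a ≡ x → to b ≡ y → (∀ i → to (f i) ≡ spoke i) →
                      ∀ v → to (relabel a b f v) ≡ v
    relabel-inverse to to-a to-b to-f v with v ≟ x | v ≟ y
    ... | yes refl | _        = to-a
    ... | no _     | yes refl = to-b
    ... | no v≢x   | no v≢y   = trans (to-f (index v)) (spoke-index v v≢x v≢y)

  x~spoke : ∀ i → adj G x (spoke i) ≡ true
  x~spoke i = E-sym G (spoke~x i)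

  y~spoke : ∀ i → adj G y (spoke i) ≡ true
  y~spoke i = E-sym G (spoke~y i)

skeleton⇒K23 : (G : Graph) (x y : V G) → Skeleton G x y 3 → adj G x y ≡ false → G ≅ K23
skeleton⇒K23 G x y S x≁y =
  ≅-by-bijection G K23 to from (relabel-inverse _ _ _ to refl refl (λ _ → refl)) from-to pres
  where
  open Skeleton S
  to : Fin 5 → V G
  to zero             = x
  to (suc zero)       = y
  to (suc (suc i))    = spoke i
  from : V G → Fin 5
  from = relabel zero (suc zero) (λ i → suc (suc i))
  from-to : ∀ a → from (to a) ≡ a
  from-to zero          = relabel-x _ _ _
  from-to (suc zero)    = relabel-y _ _ _
  from-to (suc (suc i)) = relabel-spoke _ _ _ i
  pres : ∀ a b → k23Adj a b ≡ adj G (to a) (to b)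
  pres zero          zero          = sym (irrefl G x)
  pres zero          (suc zero)    = sym x≁y
  pres zero          (suc (suc j)) = sym (x~spoke j)
  pres (suc zero)    zero          = sym (trans (Graph.sym G y x) x≁y)
  pres (suc zero)    (suc zero)    = sym (irrefl G y)
  pres (suc zero)    (suc (suc j)) = sym (y~spoke j)
  pres (suc (suc i)) zero          = sym (spoke~x i)
  pres (suc (suc i)) (suc zero)    = sym (spoke~y i)
  pres (suc (suc i)) (suc (suc j)) = sym (spoke≁spoke i j)

skeleton⇒K4e : (G : Graph) (x y : V G) → Skeleton G x y 2 → E G x y → G ≅ K4e
skeleton⇒K4e G x y S x~y =
  ≅-by-bijection G K4e to from (relabel-inverse _ _ _ to refl refl to-spoke) from-to pres
  where
  open Skeleton S
  spokeIndex : Fin 2 → Fin 4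
  spokeIndex zero       = zero
  spokeIndex (suc zero) = suc zero
  to : Fin 4 → V G
  to zero                   = spoke zero
  to (suc zero)             = spoke (suc zero)
  to (suc (suc zero))       = x
  to (suc (suc (suc zero))) = y
  to-spoke : ∀ i → to (spokeIndex i) ≡ spoke i
  to-spoke zero       = refl
  to-spoke (suc zero) = refl
  from : V G → Fin 4
  from = relabel (suc (suc zero)) (suc (suc (suc zero))) spokeIndex
  from-to : ∀ a → from (to a) ≡ a
  from-to zero                   = relabel-spoke _ _ _ zero
  from-to (suc zero)             = relabel-spoke _ _ _ (suc zero)
  from-to (suc (suc zero))       = relabel-x _ _ _
  from-to (suc (suc (suc zero))) = relabel-y _ _ _
  s₀ s₁ : Fin 2
  s₀ = zero
  s₁ = suc zero
  pres : ∀ a b → k4eAdj a b ≡ adj G (to a) (to b)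
  pres zero                   zero                   = sym (spoke≁spoke s₀ s₀)
  pres zero                   (suc zero)             = sym (spoke≁spoke s₀ s₁)
  pres zero                   (suc (suc zero))       = sym (spoke~x s₀)
  pres zero                   (suc (suc (suc zero))) = sym (spoke~y s₀)
  pres (suc zero)             zero                   = sym (spoke≁spoke s₁ s₀)
  pres (suc zero)             (suc zero)             = sym (spoke≁spoke s₁ s₁)
  pres (suc zero)             (suc (suc zero))       = sym (spoke~x s₁)
  pres (suc zero)             (suc (suc (suc zero))) = sym (spoke~y s₁)
  pres (suc (suc zero))       zero                   = sym (x~spoke s₀)
  pres (suc (suc zero))       (suc zero)             = sym (x~spoke s₁)
  pres (suc (suc zero))       (suc (suc zero))       = sym (irrefl G x)
  pres (suc (suc zero))       (suc (suc (suc zero))) = sym x~y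
  pres (suc (suc (suc zero))) zero                   = sym (y~spoke s₀)
  pres (suc (suc (suc zero))) (suc zero)             = sym (y~spoke s₁)
  pres (suc (suc (suc zero))) (suc (suc zero))       = sym (E-sym G x~y)
  pres (suc (suc (suc zero))) (suc (suc (suc zero))) = sym (irrefl G y)

reach-start : {G : Graph} {R : V G → Set} {u v : V G} → Reach G R u v → ¬ R u
reach-start (here ¬Ru)     = ¬Ru
reach-start (step ¬Ru _ _) = ¬Ru

reach-mono : {G : Graph} {R S : V G → Set} → (∀ w → S w → R w) →
             ∀ {u v} → Reach G R u v → Reach G S u v
reach-mono S⊆R (here ¬Ru)     = here (λ Su → ¬Ru (S⊆R _ Su))
reach-mono S⊆R (step ¬Ru e r) = step (λ Su → ¬Ru (S⊆R _ Su)) e (reach-mono S⊆R r)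

first-step : {G : Graph} {R : V G → Set} {u v : V G} → u ≢ v → Reach G R u v →
             ∃ λ w → ¬ R w × E G u w
first-step u≢v (here _)        = ⊥-elim (u≢v refl)
first-step _   (step _ e walk) = _ , reach-start walk , e

module Components (G : Graph) (x y : V G) (k : ℕ)
                  (2conn : TwoConnected G) (comps : HasComponents G (Pair G x y) k) where

  open CutTest G x y public

  comp : V G → Fin k
  comp = proj₁ comps

  same⇒reach : ∀ u v → ¬ Cut u → ¬ Cut v → comp u ≡ comp v → Reach G Cut u v
  same⇒reach u v ¬Cu ¬Cv = proj₁ (proj₁ (proj₂ comps) u v ¬Cu ¬Cv)

  reach⇒same : ∀ u v → ¬ Cut u → ¬ Cut v → Reach G Cut u v → comp u ≡ comp v
  reach⇒same u v ¬Cu ¬Cv = proj₂ (proj₁ (proj₂ comps) u v ¬Cu ¬Cv)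

  edge⇒same : ∀ u v → ¬ Cut u → ¬ Cut v → E G u v → comp u ≡ comp v
  edge⇒same u v ¬Cu ¬Cv e = reach⇒same u v ¬Cu ¬Cv (step ¬Cu e (here ¬Cv))

  rep : Fin k → V G
  rep i = proj₁ (proj₂ (proj₂ comps) i)

  rep-off : ∀ i → ¬ Cut (rep i)
  rep-off i = proj₁ (proj₂ (proj₂ (proj₂ comps) i))

  rep-comp : ∀ i → comp (rep i) ≡ i
  rep-comp i = proj₂ (proj₂ (proj₂ (proj₂ comps) i))

  avoiding : (b : V G) → ∀ u v → u ≢ b → v ≢ b → Reach G (λ w → w ≡ b) u v
  avoiding b = proj₂ (proj₂ (proj₂ 2conn) b)

  -- x ≠ y: otherwise G \ {x , y} = G \ x would be connected.
  cut-distinct : 2 ≤ k → x ≢ y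
  cut-distinct (s≤s (s≤s _)) refl =
    0≢1+n (trans (sym (rep-comp zero)) (trans sameComp (rep-comp (suc zero))))
    where
    r₀ = rep zero
    r₁ = rep (suc zero)
    sameComp : comp r₀ ≡ comp r₁
    sameComp = reach⇒same r₀ r₁ (rep-off zero) (rep-off (suc zero))
      (reach-mono (λ { w (inj₁ w≡x) → w≡x ; w (inj₂ w≡x) → w≡x })
                  (avoiding x r₀ r₁ (rep-off zero ∘ inj₁) (rep-off (suc zero) ∘ inj₁)))

  record Attachment (a : V G) (i : Fin k) : Set where
    field
      vertex : V G
      off    : ¬ Cut vertex
      inComp : comp vertex ≡ i
      edge   : E G vertex a

  enter : (a b : V G) → Cut a → (∀ w → w ≢ a → w ≢ b → ¬ Cut w) →
          ∀ {u} → Reach G (λ w → w ≡ b) u a → ¬ Cut u → Attachment a (comp u)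
  enter a b Ca onlyAB (here _) ¬Cu = ⊥-elim (¬Cu Ca)
  enter a b Ca onlyAB {u} (step {w = w} _ e walk) ¬Cu with w ≟ a
  ... | yes refl = record { vertex = u ; off = ¬Cu ; inComp = refl ; edge = e }
  ... | no w≢a =
    let ¬Cw = onlyAB w w≢a (reach-start walk)
        att = enter a b Ca onlyAB walk ¬Cw
        open Attachment att
    in record { vertex = vertex ; off = off ; edge = edge
              ; inComp = trans inComp (sym (edge⇒same u w ¬Cu ¬Cw e)) }

  Nontrivial : Fin k → Set
  Nontrivial i = ∃ λ u → ∃ λ v → u ≢ v × ¬ Cut u × ¬ Cut v × comp u ≡ i × comp v ≡ i

  -- Every vertex of a nontrivial component has a neighbour off the cut:
  -- the first step of a walk to another vertex of its component.
  nontrivial-neighbour : ∀ {i} → Nontrivial i → ∀ w → ¬ Cut w → comp w ≡ i →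
                         ∃ λ w′ → ¬ Cut w′ × E G w w′
  nontrivial-neighbour (u , v , u≢v , ¬Cu , ¬Cv , cu , cv) w ¬Cw cw with w ≟ u
  ... | yes refl = first-step u≢v (same⇒reach w v ¬Cw ¬Cv (trans cw (sym cv)))
  ... | no w≢u   = first-step w≢u (same⇒reach w u ¬Cw ¬Cu (trans cw (sym cu)))

  module Separated (x≢y : x ≢ y) where

    -- By 2-connectivity every component is attached to both x and y.
    attach-x : ∀ i → Attachment x i
    attach-x i = subst (Attachment x) (rep-comp i)
      (enter x y (inj₁ refl) (λ w w≢x w≢y → [ w≢x , w≢y ])
             (avoiding y (rep i) x (rep-off i ∘ inj₂) x≢y) (rep-off i))

    attach-y : ∀ i → Attachment y i
    attach-y i = subst (Attachment y) (rep-comp i)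
      (enter y x (inj₂ refl) (λ w w≢y w≢x → [ w≢x , w≢y ])
             (avoiding x (rep i) y (rep-off i ∘ inj₁) (x≢y ∘ sym)) (rep-off i))

    offCut-x-y : ∀ {w v} → ¬ Cut w → ¬ SamePair w x v y
    offCut-x-y _   (inj₁ (_ , x≡y)) = x≢y x≡y
    offCut-x-y ¬Cw (inj₂ (w≡y , _)) = ¬Cw (inj₂ w≡y)

    offCut-pair : ∀ {a b v c} → ¬ Cut a → ¬ Cut b → Cut c → ¬ SamePair a b v c
    offCut-pair _   ¬Cb Cc (inj₁ (_ , refl)) = ¬Cb Cc
    offCut-pair ¬Ca _   Cc (inj₂ (refl , _)) = ¬Ca Cc

    offCut-xy : ∀ {a c} → ¬ Cut a → ¬ SamePair x y a c
    offCut-xy ¬Ca sp = ¬Ca (SamePair-member sp)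

    -- Evidence that the components in O supply spare edges for a side
    -- avoiding them: two such components, a nontrivial one, or -- for a side
    -- that drops xy -- one component together with the edge xy.
    data Spare (O : Fin k → Set) (keep : Bool) : Set where
      twoComponents : ∀ j₁ j₂ → j₁ ≢ j₂ → O j₁ → O j₂ → Spare O keep
      bigComponent  : ∀ j → O j → Nontrivial j → Spare O keep
      withCutEdge   : ∀ j → O j → keep ≡ false → E G x y → Spare O keep

    Spare-map : ∀ {O O′ keep} → (∀ j → O j → O′ j) → Spare O keep → Spare O′ keep
    Spare-map f (twoComponents j₁ j₂ j₁≢j₂ O₁ O₂) = twoComponents j₁ j₂ j₁≢j₂ (f j₁ O₁) (f j₂ O₂)
    Spare-map f (bigComponent j Oj big)          = bigComponent j (f j Oj) big
    Spare-map f (withCutEdge j Oj dropped xy)    = withCutEdge j (f j Oj) dropped xy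

    module _ (P : V G → Bool) (Px : P x ≡ true) (Py : P y ≡ true) (keep : Bool) where
      open SideGraph G x≢y P Px Py keep

      spareEdges : (O : Fin k → Set) →
                   (∀ j → O j → ∀ w → ¬ Cut w → comp w ≡ j → P w ≡ false) →
                   Spare O keep → SpareEdges
      spareEdges O missing (twoComponents j₁ j₂ j₁≢j₂ O₁ O₂) = record
        { α = A₁.vertex ; β = B₁.vertex ; γ₁ = A₂.vertex ; γ₂ = x
        ; α-x = A₁.edge ; β-y = B₁.edge ; γ = A₂.edge
        ; α-out = missing j₁ O₁ _ A₁.off A₁.inComp
        ; β-out = missing j₁ O₁ _ B₁.off B₁.inComp
        ; γ≢αx = distinct
        ; γ≢βy = offCut-x-y A₂.off
        ; γ-not-inner = λ i j _ → outside-not-inner i j (missing j₂ O₂ _ A₂.off A₂.inComp) }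
        where
        module A₁ = Attachment (attach-x j₁)
        module B₁ = Attachment (attach-y j₁)
        module A₂ = Attachment (attach-x j₂)
        distinct : ¬ SamePair A₂.vertex x A₁.vertex x
        distinct (inj₁ (same , _)) = j₁≢j₂ (trans (sym A₁.inComp) (trans (cong comp (sym same)) A₂.inComp))
        distinct (inj₂ (A₂≡x , _)) = A₂.off (inj₁ A₂≡x)
      spareEdges O missing (bigComponent j Oj big) = record
        { α = A.vertex ; β = B.vertex ; γ₁ = A.vertex ; γ₂ = proj₁ inner
        ; α-x = A.edge ; β-y = B.edge ; γ = proj₂ (proj₂ inner)
        ; α-out = missing j Oj _ A.off A.inComp
        ; β-out = missing j Oj _ B.off B.inComp
        ; γ≢αx = offCut-pair A.off (proj₁ (proj₂ inner)) (inj₁ refl)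
        ; γ≢βy = offCut-pair A.off (proj₁ (proj₂ inner)) (inj₂ refl)
        ; γ-not-inner = λ i i′ _ → outside-not-inner i i′ (missing j Oj _ A.off A.inComp) }
        where
        module A = Attachment (attach-x j)
        module B = Attachment (attach-y j)
        inner = nontrivial-neighbour big A.vertex A.off A.inComp
      spareEdges O missing (withCutEdge j Oj dropped xy) = record
        { α = A.vertex ; β = B.vertex ; γ₁ = x ; γ₂ = y
        ; α-x = A.edge ; β-y = B.edge ; γ = xy
        ; α-out = missing j Oj _ A.off A.inComp
        ; β-out = missing j Oj _ B.off B.inComp
        ; γ≢αx = offCut-xy A.off
        ; γ≢βy = offCut-xy B.off
        ; γ-not-inner = cutEdge-not-inner dropped }
        where
        module A = Attachment (attach-x j)
        module B = Attachment (attach-y j)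

    module Separation (Q : Fin k → Bool) where

      side₁ side₂ : V G → Bool
      side₁ w = isCut w ∨ Q (comp w)
      side₂ w = isCut w ∨ not (Q (comp w))

      Near : V G → V G → Set
      Near v w = Cut w ⊎ comp w ≡ comp v

      side₁-cut : ∀ {w} → Cut w → side₁ w ≡ true
      side₁-cut Cw rewrite isCut-true Cw = refl

      side₂-cut : ∀ {w} → Cut w → side₂ w ≡ true
      side₂-cut Cw rewrite isCut-true Cw = refl

      side₁-near : ∀ {v w} → Q (comp v) ≡ true → Near v w → side₁ w ≡ true
      side₁-near _ (inj₁ Cw) = side₁-cut Cw
      side₁-near {w = w} q (inj₂ same) rewrite trans (cong Q same) q = ∨-zeroʳ (isCut w)

      side₂-near : ∀ {v w} → Q (comp v) ≡ false → Near v w → side₂ w ≡ true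
      side₂-near _ (inj₁ Cw) = side₂-cut Cw
      side₂-near {w = w} q (inj₂ same) rewrite trans (cong Q same) q = ∨-zeroʳ (isCut w)

      side₁-off : ∀ {w} → ¬ Cut w → side₁ w ≡ Q (comp w)
      side₁-off ¬Cw rewrite isCut-false ¬Cw = refl

      side₂-off : ∀ {w} → ¬ Cut w → side₂ w ≡ not (Q (comp w))
      side₂-off ¬Cw rewrite isCut-false ¬Cw = refl

      side₁-missing : ∀ j → Q j ≡ false → ∀ w → ¬ Cut w → comp w ≡ j → side₁ w ≡ false
      side₁-missing j q w ¬Cw refl = trans (side₁-off ¬Cw) q

      side₂-missing : ∀ j → Q j ≡ true → ∀ w → ¬ Cut w → comp w ≡ j → side₂ w ≡ false
      side₂-missing j q w ¬Cw refl = trans (side₂-off ¬Cw) (cong not q)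

      bothNear : ∀ v {w w′} → Near v w → Near v w′ →
                 (side₁ w ≡ true × side₁ w′ ≡ true) ⊎ (side₂ w ≡ true × side₂ w′ ≡ true)
      bothNear v n n′ with Q (comp v) in q
      ... | true  = inj₁ (side₁-near q n , side₁-near q n′)
      ... | false = inj₂ (side₂-near q n , side₂-near q n′)

      cover : ∀ v → side₁ v ≡ true ⊎ side₂ v ≡ true
      cover v with bothNear v {v} {v} (inj₂ refl) (inj₂ refl)
      ... | inj₁ (s , _) = inj₁ s
      ... | inj₂ (s , _) = inj₂ s

      meet : ∀ v → side₁ v ≡ true → side₂ v ≡ true → Cut v
      meet v s₁ s₂ = decidable-stable (cut? v) λ ¬Cv →
        excluded (trans (sym (side₁-off ¬Cv)) s₁) (trans (sym (side₂-off ¬Cv)) s₂)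
        where
        excluded : ∀ {b} → b ≡ true → not b ≡ true → ⊥
        excluded refl ()

      closed : ∀ w w′ → E G w w′ → ¬ (Cut w × Cut w′) →
               (side₁ w ≡ true × side₁ w′ ≡ true) ⊎ (side₂ w ≡ true × side₂ w′ ≡ true)
      closed w w′ e notBoth = byCases (cut? w) (cut? w′)
        where
        byCases : Dec (Cut w) → Dec (Cut w′) →
                  (side₁ w ≡ true × side₁ w′ ≡ true) ⊎ (side₂ w ≡ true × side₂ w′ ≡ true)
        byCases (yes Cw) (yes Cw′) = ⊥-elim (notBoth (Cw , Cw′))
        byCases (yes Cw) (no _)    = bothNear w′ (inj₁ Cw) (inj₂ refl)
        byCases (no _)   (yes Cw′) = bothNear w (inj₂ refl) (inj₁ Cw′)
        byCases (no ¬Cw) (no ¬Cw′) = bothNear w (inj₂ refl) (inj₂ (sym (edge⇒same w w′ ¬Cw ¬Cw′ e)))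

      open Split G x≢y side₁ side₂ (side₁-cut (inj₁ refl)) (side₁-cut (inj₂ refl))
                 (side₂-cut (inj₁ refl)) (side₂-cut (inj₂ refl)) cover meet closed

      admissible : Spare (λ j → Q j ≡ false) true → Spare (λ j → Q j ≡ true) false →
                   AdmissibleTwoCut G x y
      admissible spare₁ spare₂ =
        S₁.Side , S₂.Side , _ , _ , _ , _ , _ , _ , twoSum ,
        S₁.side-fewerEdges (spareEdges side₁ _ _ true _ side₁-missing spare₁) ,
        S₂.side-fewerEdges (spareEdges side₂ _ _ false _ side₂-missing spare₂)

    splitOff : ∀ i → Spare (λ j → j ≢ i) true → Spare (λ j → j ≡ i) false → AdmissibleTwoCut G x y
    splitOff i spare₁ spare₂ =
      admissible (Spare-map (λ j j≢i → dec-false (j ≟ i) j≢i) spare₁)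
                 (Spare-map (λ j j≡i → dec-true (j ≟ i) j≡i) spare₂)
      where open Separation (λ j → does (j ≟ i))

    nontrivial? : ∀ i → Dec (Nontrivial i)
    nontrivial? i = any? λ u → any? λ v →
      ¬? (u ≟ v) ×-dec ¬? (cut? u) ×-dec ¬? (cut? v) ×-dec (comp u ≟ i) ×-dec (comp v ≟ i)

    isolated : ∀ i → ¬ Nontrivial i → HasIsolatedComponent G Cut
    isolated i trivial = rep i , rep-off i , alone
      where
      alone : ∀ u → ¬ Cut u → Reach G Cut (rep i) u → u ≡ rep i
      alone u ¬Cu walk = decidable-stable (u ≟ rep i) λ u≢r →
        trivial (u , rep i , u≢r , ¬Cu , rep-off i ,
                 trans (sym (reach⇒same _ _ (rep-off i) ¬Cu walk)) (rep-comp i) , rep-comp i)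

    skeleton : (∀ i → ¬ Nontrivial i) → Skeleton G x y k
    skeleton trivial = record
      { x≢y = x≢y ; spoke = rep ; index = comp
      ; spoke-x = λ i → rep-off i ∘ inj₁ ; spoke-y = λ i → rep-off i ∘ inj₂
      ; index-spoke = rep-comp
      ; spoke-index = λ v v≢x v≢y → unique (rep (comp v)) v (rep-off _) [ v≢x , v≢y ] (rep-comp _)
      ; spoke~x = λ i → attached (attach-x i)
      ; spoke~y = λ i → attached (attach-y i)
      ; spoke≁spoke = nonadjacent }
      where
      unique : ∀ u v → ¬ Cut u → ¬ Cut v → comp u ≡ comp v → u ≡ v
      unique u v ¬Cu ¬Cv same = decidable-stable (u ≟ v) λ u≢v →
        trivial (comp v) (u , v , u≢v , ¬Cu , ¬Cv , same , refl)
      attached : ∀ {a i} → Attachment a i → E G (rep i) a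
      attached {a} {i} att = subst (λ w → E G w a)
        (unique vertex (rep i) off (rep-off i) (trans inComp (sym (rep-comp i)))) edge
        where open Attachment att
      nonadjacent : ∀ i j → adj G (rep i) (rep j) ≡ false
      nonadjacent i j with adj G (rep i) (rep j) in e
      ... | false = refl
      ... | true  = ⊥-elim (E-irrefl G e (unique _ _ (rep-off i) (rep-off j)
                                           (edge⇒same _ _ (rep-off i) (rep-off j) e)))

others : (i : Fin 3) → ∃ λ j₁ → ∃ λ j₂ → j₁ ≢ j₂ × j₁ ≢ i × j₂ ≢ i
others zero             = suc zero , suc (suc zero) , (λ ()) , (λ ()) , (λ ())
others (suc zero)       = zero , suc (suc zero) , (λ ()) , (λ ()) , (λ ())
others (suc (suc zero)) = zero , suc zero , (λ ()) , (λ ()) , (λ ())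

-- With four or more components, two of them against the
-- rest form an admissible split.  With exactly three, a nontrivial
-- component or the edge xy yields one; otherwise G is K_{2,3}.
threeOrMore : (G : Graph) (x y : V G) (k : ℕ) → TwoConnected G →
              HasComponents G (Pair G x y) k → ¬ AdmissibleTwoCut G x y → 3 ≤ k → G ≅ K23
threeOrMore G x y 0 _ _ _ ()
threeOrMore G x y 1 _ _ _ (s≤s ())
threeOrMore G x y 2 _ _ _ (s≤s (s≤s ()))
threeOrMore G x y (suc (suc (suc (suc m)))) 2conn comps ¬adm _ =
  ⊥-elim (¬adm (admissible (twoComponents (suc (suc zero)) (suc (suc (suc zero))) (λ ()) refl refl)
                           (twoComponents zero (suc zero) (λ ()) refl refl)))
  where
  open Components G x y (suc (suc (suc (suc m)))) 2conn comps
  open Separated (cut-distinct (s≤s (s≤s z≤n)))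
  open Separation (λ j → does (j ≟ zero) ∨ does (j ≟ suc zero))
threeOrMore G x y 3 2conn comps ¬adm _ = byCases (any? nontrivial?)
  where
  open Components G x y 3 2conn comps
  open Separated (cut-distinct (s≤s (s≤s z≤n)))
  byCases : Dec (∃ Nontrivial) → G ≅ K23
  byCases (yes (i , big)) with others i
  ... | j₁ , j₂ , j₁≢j₂ , j₁≢i , j₂≢i =
    ⊥-elim (¬adm (splitOff i (twoComponents j₁ j₂ j₁≢j₂ j₁≢i j₂≢i) (bigComponent i refl big)))
  byCases (no noneBig) with adj G x y in x~y
  ... | true  = ⊥-elim (¬adm (splitOff zero
                  (twoComponents (suc zero) (suc (suc zero)) (λ ()) (λ ()) (λ ()))
                  (withCutEdge zero refl refl x~y)))
  ... | false = skeleton⇒K23 G x y (skeleton (λ i big → noneBig (i , big))) x~y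

other : Fin 2 → Fin 2
other zero       = suc zero
other (suc zero) = zero

other-≢ : ∀ i → i ≢ other i
other-≢ zero       ()
other-≢ (suc zero) ()

-- Conclusion (2).  With two components and the edge xy, a nontrivial
-- component can be split off; otherwise G is K₄ \ e.
twoWithEdge : (G : Graph) (x y : V G) → TwoConnected G → HasComponents G (Pair G x y) 2 →
              ¬ AdmissibleTwoCut G x y → E G x y → G ≅ K4e
twoWithEdge G x y 2conn comps ¬adm x~y = byCases (any? nontrivial?)
  where
  open Components G x y 2 2conn comps
  open Separated (cut-distinct (s≤s (s≤s z≤n)))
  byCases : Dec (∃ Nontrivial) → G ≅ K4e
  byCases (yes (i , big)) =
    ⊥-elim (¬adm (splitOff (other i) (bigComponent i (other-≢ i) big) (withCutEdge (other i) refl refl x~y)))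
  byCases (no noneBig) = skeleton⇒K4e G x y (skeleton (λ i big → noneBig (i , big))) x~y

-- Conclusion (3).  With two components, if both are nontrivial then
-- either can be split off; so one of them is a single vertex.
twoComponents-isolated : (G : Graph) (x y : V G) → TwoConnected G → HasComponents G (Pair G x y) 2 →
                         ¬ AdmissibleTwoCut G x y → HasIsolatedComponent G (Pair G x y)
twoComponents-isolated G x y 2conn comps ¬adm = byCases (nontrivial? zero) (nontrivial? (suc zero))
  where
  open Components G x y 2 2conn comps
  open Separated (cut-distinct (s≤s (s≤s z≤n)))
  byCases : Dec (Nontrivial zero) → Dec (Nontrivial (suc zero)) → HasIsolatedComponent G Cut
  byCases (no trivial) _            = isolated zero trivial
  byCases (yes _)      (no trivial) = isolated (suc zero) trivial
  byCases (yes big₀)   (yes big₁)   =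
    ⊥-elim (¬adm (splitOff zero (bigComponent (suc zero) (λ ()) big₁) (bigComponent zero refl big₀)))

lemma2p2 : (G : Graph) (x y : V G) (k : ℕ) →
    TwoConnected G →
    HasComponents G (Pair G x y) k →
    2 ≤ k →
    ¬ AdmissibleTwoCut G x y →
    (3 ≤ k → G ≅ K23)
    × (k ≡ 2 → E G x y → G ≅ K4e)
    × (k ≡ 2 → ¬ E G x y → HasIsolatedComponent G (Pair G x y))
lemma2p2 G x y k 2conn comps _ ¬adm =
    threeOrMore G x y k 2conn comps ¬adm
  , (λ { refl x~y → twoWithEdge G x y 2conn comps ¬adm x~y })
  , (λ { refl _ → twoComponents-isolated G x y 2conn comps ¬adm })
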